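{- The relation $\succeq^{+}$ satisfies the defining clauses of a 1-naive faster-than relation on all terms (including open terms): for all $(P,Q)\in\succeq^{+}$ and $\alpha\in\mathcal A$, (1) $P\xrightarrow{\alpha}P'$ implies $Q\xrightarrow{\alpha}Q'$ for some $Q'$ with $P'\succeq^{+}Q'$; (2) $Q\xrightarrow{\alpha}Q'$ implies $P\xrightarrow{\alpha}P'$ for some $P'$ with $P'\succeq^{+}Q'$; (3) $P\xrightarrow{\sigma}_1P'$ implies $Q\xrightarrow{\sigma}_1Q'$ for some $Q'$ with $P'\succeq^{+}Q'$. Consequently, $\succeq^{+}\cap(\mathcal P\times\mathcal P)$ is a 1-naive faster-than relation and $\succeq^{+}\cap(\mathcal P\times\mathcal P)\subseteq\sqsupseteq_{1\text{ -nv}}$.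
   Context: TACS. Fix a countable set $\Lambda$ of action names; $\overline{\Lambda}=\{\overline a : a\in\Lambda\}$ with $\overline{\overline a}=a$; $\mathcal A=\Lambda\cup\overline\Lambda\cup\{\tau\}$ (ranged over by $\alpha$), and $a$ ranges over $\Lambda\cup\overline\Lambda$. Terms (set $\widehat{\mathcal P}$, possibly open) are generated by $P::=\mathbf 0\mid x\mid \alpha.P\mid \sigma.P\mid P+P\mid P|P\mid P\backslash L\mid P[f]\mid \mu x.P$, where $x$ ranges over a countably infinite set of variables, $L\subseteq\mathcal A\setminus\{\tau\}$ is finite, and $f:\mathcal A\to\mathcal A$ satisfies $f(\tau)=\tau$, $f(\overline a)=\overline{f(a)}$ and $f(\alpha)\neq\alpha$ for only finitely many $\alpha$. $\mu x$ binds $x$; $P[Q/x]$ is substitution of $Q$ for the free occurrences of $x$. A variable is guarded in a term if each of its occurrences is in the scope of an action prefix $\alpha.\_$ (a $\sigma$-prefix does not count); in every term $\mu x.P$, $x$ must be guarded in $P$. Processes (set $\mathcal P$) are the closed terms. $\overline L=\{\overline a: a\in L\}$. Urgent sets: $\mathcal U(\sigma.P)=\mathcal U(\mathbf 0)=\mathcal U(x)=\emptyset$, $\mathcal U(\alpha.P)=\{\alpha\}$, $\mathcal U(P+Q)=\mathcal U(P)\cup\mathcal U(Q)$, $\mathcal U(P|Q)=\mathcal U(P)\cup\mathcal U(Q)\cup\{\tau\mid \mathcal U(P)\cap\overline{\mathcal U(Q)}\neq\emptyset\}$, $\mathcal U(P\backslash L)=\mathcal U(P)\setminus(L\cup\overline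 L)$, $\mathcal U(P[f])=\{f(\alpha):\alpha\in\mathcal U(P)\}$, $\mathcal U(\mu x.P)=\mathcal U(P)$. Action transitions $\xrightarrow{\alpha}$ are the least relations with: $\alpha.P\xrightarrow{\alpha}P$; if $P\xrightarrow{\alpha}P'$ then $\sigma.P\xrightarrow{\alpha}P'$, $\mu x.P\xrightarrow{\alpha}P'[\mu x.P/x]$, $P+Q\xrightarrow{\alpha}P'$, $Q+P\xrightarrow{\alpha}P'$, $P|Q\xrightarrow{\alpha}P'|Q$, $Q|P\xrightarrow{\alpha}Q|P'$, $P[f]\xrightarrow{f(\alpha)}P'[f]$, and $P\backslash L\xrightarrow{\alpha}P'\backslash L$ if $\alpha\notin L\cup\overline L$; if $P\xrightarrow{a}P'$ and $Q\xrightarrow{\overline a}Q'$ then $P|Q\xrightarrow{\tau}P'|Q'$. Clock transitions $\xrightarrow{\sigma}_1$ form the least relation with: $\mathbf 0\xrightarrow{\sigma}_1\mathbf 0$; $a.P\xrightarrow{\sigma}_1 a.P$ for $a\in\Lambda\cup\overline\Lambda$; $\sigma.P\xrightarrow{\sigma}_1P$; if $P\xrightarrow{\sigma}_1P'$ then $\mu x.P\xrightarrow{\sigma}_1P'[\mu x.P/x]$, $P\backslash L\xrightarrow{\sigma}_1P'\backslash L$, $P[f]\xrightarrow{\sigma}_1P'[f]$; if $P\xrightarrow{\sigma}_1P'$ and $Q\xrightarrow{\sigma}_1Q'$ then $P+Q\xrightarrow{\sigma}_1P'+Q'$, and $P|Q\xrightarrow{\sigma}_1P'|Q'$ provided $\tau\notin\mathcal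 U(P|Q)$. A relation $\mathcal R\subseteq\mathcal P\times\mathcal P$ is a 1-naive faster-than relation if for all $(P,Q)\in\mathcal R$, $\alpha\in\mathcal A$: (1) $P\xrightarrow{\alpha}P'$ implies $\exists Q'$. $Q\xrightarrow{\alpha}Q'$, $(P',Q')\in\mathcal R$; (2) $Q\xrightarrow{\alpha}Q'$ implies $\exists P'$. $P\xrightarrow{\alpha}P'$, $(P',Q')\in\mathcal R$; (3) $P\xrightarrow{\sigma}_1P'$ implies $\exists Q'$. $Q\xrightarrow{\sigma}_1Q'$, $(P',Q')\in\mathcal R$. $P\sqsupseteq_{1\text{ -nv}}Q$ iff $(P,Q)$ lies in some 1-naive faster-than relation. The syntactic relation $\succeq\subseteq\widehat{\mathcal P}\times\widehat{\mathcal P}$ is the smallest relation such that for all terms: $P\succeq P$; $P\succeq\sigma.P$; if $P'\succeq P$ and $Q'\succeq Q$ then $P'|Q'\succeq P|Q$ and $P'+Q'\succeq P+Q$; if $P'\succeq P$ then $P'\backslash L\succeq P\backslash L$ and $P'[f]\succeq P[f]$; if $P'\succeq P$ and $x$ is guarded in $P$ then $P'[\mu x.P/x]\succeq\mu x.P$. $\succeq^{+}$ denotes the transitive closure of $\succeq$. -}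

module Defs where

open import Data.Nat using (ℕ; zero; suc; _<_)
open import Data.List using (List)
open import Data.List.Membership.Propositional using (_∈_; _∉_)
open import Data.Product using (Σ; ∃; _×_; _,_)
open import Data.Sum using (_⊎_)
open import Data.Unit using (⊤)
open import Data.Empty using (⊥)
open import Relation.Nullary using (¬_)
open import Relation.Binary.PropositionalEquality using (_≡_; _≢_)
open import Relation.Binary.Construct.Closure.Transitive using (TransClosure)

-- Actions.  Λ = ℕ (a countable set of names).

-- visible actions Λ ∪ Λ̄
data Vis : Set where
  nm : ℕ → Vis
  co : ℕ → Vis

compl : Vis → Vis
compl (nm n) = co n
compl (co n) = nm n

data Act : Set where
  vis : Vis → Act
  τ   : Act

-- Since f(ā) = overline(f(a)) is only
-- meaningful when f(a) is visible, f maps visible actions to visible ones.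
record Relab : Set where
  field
    fv     : Vis → Vis
    fv-co  : ∀ a → fv (compl a) ≡ compl (fv a)
    finite : Σ (List Vis) λ xs → ∀ a → a ∉ xs → fv a ≡ a

appR : Relab → Act → Act
appR f (vis a) = vis (Relab.fv f a)
appR f τ       = τ

-- α ∈ L ∪ L̄  for a finite set L ⊆ 𝒜∖{τ} (represented by a list)
InLL : List Vis → Act → Set
InLL L (vis a) = a ∈ L ⊎ compl a ∈ L
InLL L τ       = ⊥

-- Terms, with de Bruijn indices for variables (μ binds index 0).

data Tm : Set where
  𝟎    : Tm
  var  : ℕ → Tm
  _∙_  : Act → Tm → Tm
  σ∙_  : Tm → Tm
  _⊕_  : Tm → Tm → Tm
  _∥_  : Tm → Tm → Tm
  _∖_  : Tm → List Vis → Tm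
  _⟦_⟧ : Tm → Relab → Tm
  μ_   : Tm → Tm

ext : (ℕ → ℕ) → ℕ → ℕ
ext ρ zero    = zero
ext ρ (suc n) = suc (ρ n)

rename : (ℕ → ℕ) → Tm → Tm
rename ρ 𝟎        = 𝟎
rename ρ (var n)  = var (ρ n)
rename ρ (α ∙ P)  = α ∙ rename ρ P
rename ρ (σ∙ P)   = σ∙ rename ρ P
rename ρ (P ⊕ Q)  = rename ρ P ⊕ rename ρ Q
rename ρ (P ∥ Q)  = rename ρ P ∥ rename ρ Q
rename ρ (P ∖ L)  = rename ρ P ∖ L
rename ρ (P ⟦ f ⟧) = rename ρ P ⟦ f ⟧
rename ρ (μ P)    = μ rename (ext ρ) P

exts : (ℕ → Tm) → ℕ → Tm
exts s zero    = var zero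
exts s (suc n) = rename suc (s n)

subst : (ℕ → Tm) → Tm → Tm
subst s 𝟎        = 𝟎
subst s (var n)  = s n
subst s (α ∙ P)  = α ∙ subst s P
subst s (σ∙ P)   = σ∙ subst s P
subst s (P ⊕ Q)  = subst s P ⊕ subst s Q
subst s (P ∥ Q)  = subst s P ∥ subst s Q
subst s (P ∖ L)  = subst s P ∖ L
subst s (P ⟦ f ⟧) = subst s P ⟦ f ⟧
subst s (μ P)    = μ subst (exts s) P

-- P [ Q / x ] where x is the variable bound by the enclosing μ (index 0)
sub0 : Tm → Tm → Tm
sub0 P Q = subst s P
  where
  s : ℕ → Tm
  s zero    = Q
  s (suc n) = var n

Guarded : ℕ → Tm → Set
Guarded x 𝟎         = ⊤
Guarded x (var y)   = y ≢ x
Guarded x (α ∙ P)   = ⊤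
Guarded x (σ∙ P)    = Guarded x P
Guarded x (P ⊕ Q)   = Guarded x P × Guarded x Q
Guarded x (P ∥ Q)   = Guarded x P × Guarded x Q
Guarded x (P ∖ L)   = Guarded x P
Guarded x (P ⟦ f ⟧) = Guarded x P
Guarded x (μ P)     = Guarded (suc x) P

WF : Tm → Set
WF 𝟎         = ⊤
WF (var y)   = ⊤
WF (α ∙ P)   = WF P
WF (σ∙ P)    = WF P
WF (P ⊕ Q)   = WF P × WF Q
WF (P ∥ Q)   = WF P × WF Q
WF (P ∖ L)   = WF P
WF (P ⟦ f ⟧) = WF P
WF (μ P)     = Guarded zero P × WF P

ClosedUnder : ℕ → Tm → Set
ClosedUnder n 𝟎         = ⊤
ClosedUnder n (var y)   = y < n
ClosedUnder n (α ∙ P)   = ClosedUnder n P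
ClosedUnder n (σ∙ P)    = ClosedUnder n P
ClosedUnder n (P ⊕ Q)   = ClosedUnder n P × ClosedUnder n Q
ClosedUnder n (P ∥ Q)   = ClosedUnder n P × ClosedUnder n Q
ClosedUnder n (P ∖ L)   = ClosedUnder n P
ClosedUnder n (P ⟦ f ⟧) = ClosedUnder n P
ClosedUnder n (μ P)     = ClosedUnder (suc n) P

IsProc : Tm → Set
IsProc P = WF P × ClosedUnder zero P

-- Urgent sets, as predicates: U P α  means  α ∈ 𝒰(P)

U : Tm → Act → Set
U 𝟎         β = ⊥
U (var x)   β = ⊥
U (α ∙ P)   β = α ≡ β
U (σ∙ P)    β = ⊥
U (P ⊕ Q)   β = U P β ⊎ U Q β
U (P ∥ Q)   β = U P β ⊎ U Q β ⊎ (β ≡ τ × ∃ λ (a : Vis) → U P (vis a) × U Q (vis (compl a)))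
U (P ∖ L)   β = U P β × ¬ InLL L β
U (P ⟦ f ⟧) β = ∃ λ α → U P α × appR f α ≡ β
U (μ P)     β = U P β

infix 4 _—[_]→_ _—σ→_ _≽_

data _—[_]→_ : Tm → Act → Tm → Set where
  pre  : ∀ {α P} → (α ∙ P) —[ α ]→ P
  sigT : ∀ {α P P'} → P —[ α ]→ P' → (σ∙ P) —[ α ]→ P'
  muT  : ∀ {α P P'} → P —[ α ]→ P' → (μ P) —[ α ]→ sub0 P' (μ P)
  sumL : ∀ {α P P' Q} → P —[ α ]→ P' → (P ⊕ Q) —[ α ]→ P'
  sumR : ∀ {α P P' Q} → P —[ α ]→ P' → (Q ⊕ P) —[ α ]→ P'
  parL : ∀ {α P P' Q} → P —[ α ]→ P' → (P ∥ Q) —[ α ]→ (P' ∥ Q)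
  parR : ∀ {α P P' Q} → P —[ α ]→ P' → (Q ∥ P) —[ α ]→ (Q ∥ P')
  renT : ∀ {α P P' f} → P —[ α ]→ P' → (P ⟦ f ⟧) —[ appR f α ]→ (P' ⟦ f ⟧)
  resT : ∀ {α P P' L} → P —[ α ]→ P' → ¬ InLL L α → (P ∖ L) —[ α ]→ (P' ∖ L)
  com  : ∀ {a P P' Q Q'} → P —[ vis a ]→ P' → Q —[ vis (compl a) ]→ Q' →
         (P ∥ Q) —[ τ ]→ (P' ∥ Q')

data _—σ→_ : Tm → Tm → Set where
  nilC : 𝟎 —σ→ 𝟎
  actC : ∀ {a P} → (vis a ∙ P) —σ→ (vis a ∙ P)
  sigC : ∀ {P} → (σ∙ P) —σ→ P
  muC  : ∀ {P P'} → P —σ→ P' → (μ P) —σ→ sub0 P' (μ P)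
  resC : ∀ {P P' L} → P —σ→ P' → (P ∖ L) —σ→ (P' ∖ L)
  renC : ∀ {P P' f} → P —σ→ P' → (P ⟦ f ⟧) —σ→ (P' ⟦ f ⟧)
  sumC : ∀ {P P' Q Q'} → P —σ→ P' → Q —σ→ Q' → (P ⊕ Q) —σ→ (P' ⊕ Q')
  parC : ∀ {P P' Q Q'} → P —σ→ P' → Q —σ→ Q' → ¬ U (P ∥ Q) τ →
         (P ∥ Q) —σ→ (P' ∥ Q')

data _≽_ : Tm → Tm → Set where
  ≽-refl : ∀ {P} → P ≽ P
  ≽-sig  : ∀ {P} → P ≽ (σ∙ P)
  ≽-par  : ∀ {P P' Q Q'} → P' ≽ P → Q' ≽ Q → (P' ∥ Q') ≽ (P ∥ Q)
  ≽-sum  : ∀ {P P' Q Q'} → P' ≽ P → Q' ≽ Q → (P' ⊕ Q') ≽ (P ⊕ Q)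
  ≽-res  : ∀ {P P' L} → P' ≽ P → (P' ∖ L) ≽ (P ∖ L)
  ≽-ren  : ∀ {P P' f} → P' ≽ P → (P' ⟦ f ⟧) ≽ (P ⟦ f ⟧)
  ≽-mu   : ∀ {P P'} → P' ≽ P → Guarded zero P → sub0 P' (μ P) ≽ (μ P)

_≽̂_ : Tm → Tm → Set
P ≽̂ Q = WF P × WF Q × P ≽ Q

_≽⁺_ : Tm → Tm → Set
_≽⁺_ = TransClosure _≽̂_

Clauses : (Tm → Tm → Set) → Tm → Tm → Set
Clauses R P Q =
  (∀ α P' → P —[ α ]→ P' → ∃ λ Q' → Q —[ α ]→ Q' × R P' Q') ×
  (∀ α Q' → Q —[ α ]→ Q' → ∃ λ P' → P —[ α ]→ P' × R P' Q') ×
  (∀ P' → P —σ→ P' → ∃ λ Q' → Q —σ→ Q' × R P' Q')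

NaiveFT : (Tm → Tm → Set) → Set
NaiveFT R = ∀ P Q → R P Q → IsProc P × IsProc Q × Clauses R P Q

_⊒1nv_ : Tm → Tm → Set₁
P ⊒1nv Q = Σ (Tm → Tm → Set) λ R → NaiveFT R × R P Q

≽⁺∩Proc : Tm → Tm → Set
≽⁺∩Proc P Q = IsProc P × IsProc Q × P ≽⁺ Q

module Submission where

-- A single ≽-step only inserts σ-prefixes or unfolds a recursion, so it is a
-- strong bisimulation for action transitions. For the clock, σ.P —σ→ P matches
-- a clock step P —σ→ P', because clock steps only strip σ-prefixes and so
-- P' ≽ P; the side condition of parallel clock steps transfers because urgent
-- sets grow along ≽. The unfolding clause P'[μP/x] ≽ μP works because x is
-- guarded in P': every transition of P'[μP/x] already comes from one of P'.
-- All clauses compose along chains, which gives ≽⁺.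

open import Defs
open import Data.Empty using (⊥; ⊥-elim)
open import Data.Nat using (ℕ; zero; suc; _<_; s≤s; z≤n)
open import Data.Nat.Properties using (suc-injective)
open import Data.Product using (∃; _×_; _,_; map₂)
open import Data.Sum using (inj₁; inj₂)
open import Data.Unit using (tt)
open import Relation.Binary.PropositionalEquality as Eq using (_≡_; _≢_; refl; sym; trans; cong; cong₂; module ≡-Reasoning)
open import Relation.Binary.Construct.Closure.Transitive using (TransClosure; [_]; _∷_)

rename-rename : ∀ {ρ ρ′ ρ″} → (∀ n → ρ (ρ′ n) ≡ ρ″ n) →
                ∀ t → rename ρ (rename ρ′ t) ≡ rename ρ″ t
rename-rename h 𝟎         = refl
rename-rename h (var n)   = cong var (h n)
rename-rename h (α ∙ t)   = cong (α ∙_) (rename-rename h t)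
rename-rename h (σ∙ t)    = cong σ∙_ (rename-rename h t)
rename-rename h (t ⊕ u)   = cong₂ _⊕_ (rename-rename h t) (rename-rename h u)
rename-rename h (t ∥ u)   = cong₂ _∥_ (rename-rename h t) (rename-rename h u)
rename-rename h (t ∖ L)   = cong (_∖ L) (rename-rename h t)
rename-rename h (t ⟦ f ⟧) = cong (_⟦ f ⟧) (rename-rename h t)
rename-rename {ρ} {ρ′} {ρ″} h (μ t) = cong μ_ (rename-rename h′ t)
  where
  h′ : ∀ n → ext ρ (ext ρ′ n) ≡ ext ρ″ n
  h′ zero    = refl
  h′ (suc n) = cong suc (h n)

subst-rename : ∀ {s ρ s′} → (∀ n → s (ρ n) ≡ s′ n) →
               ∀ t → subst s (rename ρ t) ≡ subst s′ t
subst-rename h 𝟎         = refl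
subst-rename h (var n)   = h n
subst-rename h (α ∙ t)   = cong (α ∙_) (subst-rename h t)
subst-rename h (σ∙ t)    = cong σ∙_ (subst-rename h t)
subst-rename h (t ⊕ u)   = cong₂ _⊕_ (subst-rename h t) (subst-rename h u)
subst-rename h (t ∥ u)   = cong₂ _∥_ (subst-rename h t) (subst-rename h u)
subst-rename h (t ∖ L)   = cong (_∖ L) (subst-rename h t)
subst-rename h (t ⟦ f ⟧) = cong (_⟦ f ⟧) (subst-rename h t)
subst-rename {s} {ρ} {s′} h (μ t) = cong μ_ (subst-rename h′ t)
  where
  h′ : ∀ n → exts s (ext ρ n) ≡ exts s′ n
  h′ zero    = refl
  h′ (suc n) = cong (rename suc) (h n)

rename-subst : ∀ {ρ s s′} → (∀ n → rename ρ (s n) ≡ s′ n) →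
               ∀ t → rename ρ (subst s t) ≡ subst s′ t
rename-subst h 𝟎         = refl
rename-subst h (var n)   = h n
rename-subst h (α ∙ t)   = cong (α ∙_) (rename-subst h t)
rename-subst h (σ∙ t)    = cong σ∙_ (rename-subst h t)
rename-subst h (t ⊕ u)   = cong₂ _⊕_ (rename-subst h t) (rename-subst h u)
rename-subst h (t ∥ u)   = cong₂ _∥_ (rename-subst h t) (rename-subst h u)
rename-subst h (t ∖ L)   = cong (_∖ L) (rename-subst h t)
rename-subst h (t ⟦ f ⟧) = cong (_⟦ f ⟧) (rename-subst h t)
rename-subst {ρ} {s} {s′} h (μ t) = cong μ_ (rename-subst h′ t)
  where
  open ≡-Reasoning
  h′ : ∀ n → rename (ext ρ) (exts s n) ≡ exts s′ n
  h′ zero    = refl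
  h′ (suc n) = begin
    rename (ext ρ) (rename suc (s n))  ≡⟨ rename-rename (λ _ → refl) (s n) ⟩
    rename (λ m → suc (ρ m)) (s n)     ≡⟨ sym (rename-rename (λ _ → refl) (s n)) ⟩
    rename suc (rename ρ (s n))        ≡⟨ cong (rename suc) (h n) ⟩
    rename suc (s′ n)                  ∎

subst-subst : ∀ {s₂ s₁ s₃} → (∀ n → subst s₂ (s₁ n) ≡ s₃ n) →
              ∀ t → subst s₂ (subst s₁ t) ≡ subst s₃ t
subst-subst h 𝟎         = refl
subst-subst h (var n)   = h n
subst-subst h (α ∙ t)   = cong (α ∙_) (subst-subst h t)
subst-subst h (σ∙ t)    = cong σ∙_ (subst-subst h t)
subst-subst h (t ⊕ u)   = cong₂ _⊕_ (subst-subst h t) (subst-subst h u)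
subst-subst h (t ∥ u)   = cong₂ _∥_ (subst-subst h t) (subst-subst h u)
subst-subst h (t ∖ L)   = cong (_∖ L) (subst-subst h t)
subst-subst h (t ⟦ f ⟧) = cong (_⟦ f ⟧) (subst-subst h t)
subst-subst {s₂} {s₁} {s₃} h (μ t) = cong μ_ (subst-subst h′ t)
  where
  open ≡-Reasoning
  h′ : ∀ n → subst (exts s₂) (exts s₁ n) ≡ exts s₃ n
  h′ zero    = refl
  h′ (suc n) = begin
    subst (exts s₂) (rename suc (s₁ n))     ≡⟨ subst-rename (λ _ → refl) (s₁ n) ⟩
    subst (λ m → rename suc (s₂ m)) (s₁ n)  ≡⟨ sym (rename-subst (λ _ → refl) (s₁ n)) ⟩
    rename suc (subst s₂ (s₁ n))            ≡⟨ cong (rename suc) (h n) ⟩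
    rename suc (s₃ n)                       ∎

subst-id : ∀ {s} → (∀ n → s n ≡ var n) → ∀ t → subst s t ≡ t
subst-id h 𝟎         = refl
subst-id h (var n)   = h n
subst-id h (α ∙ t)   = cong (α ∙_) (subst-id h t)
subst-id h (σ∙ t)    = cong σ∙_ (subst-id h t)
subst-id h (t ⊕ u)   = cong₂ _⊕_ (subst-id h t) (subst-id h u)
subst-id h (t ∥ u)   = cong₂ _∥_ (subst-id h t) (subst-id h u)
subst-id h (t ∖ L)   = cong (_∖ L) (subst-id h t)
subst-id h (t ⟦ f ⟧) = cong (_⟦ f ⟧) (subst-id h t)
subst-id {s} h (μ t) = cong μ_ (subst-id h′ t)
  where
  h′ : ∀ n → exts s n ≡ var n
  h′ zero    = refl
  h′ (suc n) = cong (rename suc) (h n)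

subst-cong : ∀ {s s′} → (∀ n → s n ≡ s′ n) → ∀ t → subst s t ≡ subst s′ t
subst-cong {s} h t = trans (cong (subst s) (sym (subst-id (λ _ → refl) t))) (subst-subst h t)

subst-zero : Tm → ℕ → Tm
subst-zero M zero    = M
subst-zero M (suc n) = var n

-- sub0 substitutes through a local function, which is not definitionally
-- subst-zero M; this equation is the only bridge between the two.
sub0≡subst-zero : ∀ P M → sub0 P M ≡ subst (subst-zero M) P
sub0≡subst-zero P M = subst-cong h P
  where
  h : ∀ n → _ ≡ subst-zero M n
  h zero    = refl
  h (suc n) = refl

subst-sub0 : ∀ s A B → subst s (sub0 A B) ≡ sub0 (subst (exts s) A) (subst s B)
subst-sub0 s A B = begin
  subst s (sub0 A B)                                   ≡⟨ cong (subst s) (sub0≡subst-zero A B) ⟩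
  subst s (subst (subst-zero B) A)                     ≡⟨ subst-subst (λ _ → refl) A ⟩
  subst (λ n → subst s (subst-zero B n)) A             ≡⟨ subst-cong pointwise A ⟩
  subst (λ n → subst s′ (exts s n)) A                  ≡⟨ sym (subst-subst (λ _ → refl) A) ⟩
  subst s′ (subst (exts s) A)                          ≡⟨ sym (sub0≡subst-zero (subst (exts s) A) (subst s B)) ⟩
  sub0 (subst (exts s) A) (subst s B)                  ∎
  where
  open ≡-Reasoning
  s′ : ℕ → Tm
  s′ = subst-zero (subst s B)
  pointwise : ∀ n → subst s (subst-zero B n) ≡ subst s′ (exts s n)
  pointwise zero    = refl
  pointwise (suc n) = sym (trans (subst-rename {s′ = var} (λ _ → refl) (s n)) (subst-id (λ _ → refl) (s n)))

Guarded-rename : ∀ {x y ρ} t → (∀ z → z ≢ x → ρ z ≢ y) → Guarded x t → Guarded y (rename ρ t)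
Guarded-rename 𝟎         h g        = tt
Guarded-rename (var n)   h g        = h n g
Guarded-rename (α ∙ t)   h g        = tt
Guarded-rename (σ∙ t)    h g        = Guarded-rename t h g
Guarded-rename (t ⊕ u)   h (g , g′) = Guarded-rename t h g , Guarded-rename u h g′
Guarded-rename (t ∥ u)   h (g , g′) = Guarded-rename t h g , Guarded-rename u h g′
Guarded-rename (t ∖ L)   h g        = Guarded-rename t h g
Guarded-rename (t ⟦ f ⟧) h g        = Guarded-rename t h g
Guarded-rename {x} {y} {ρ} (μ t) h g = Guarded-rename t h′ g
  where
  h′ : ∀ z → z ≢ suc x → ext ρ z ≢ suc y
  h′ zero    _  ()
  h′ (suc z) z≢ e = h z (λ e′ → z≢ (cong suc e′)) (suc-injective e)

Guarded-rename-avoiding : ∀ {y ρ} t → (∀ z → ρ z ≢ y) → Guarded y (rename ρ t)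
Guarded-rename-avoiding 𝟎         h = tt
Guarded-rename-avoiding (var n)   h = h n
Guarded-rename-avoiding (α ∙ t)   h = tt
Guarded-rename-avoiding (σ∙ t)    h = Guarded-rename-avoiding t h
Guarded-rename-avoiding (t ⊕ u)   h = Guarded-rename-avoiding t h , Guarded-rename-avoiding u h
Guarded-rename-avoiding (t ∥ u)   h = Guarded-rename-avoiding t h , Guarded-rename-avoiding u h
Guarded-rename-avoiding (t ∖ L)   h = Guarded-rename-avoiding t h
Guarded-rename-avoiding (t ⟦ f ⟧) h = Guarded-rename-avoiding t h
Guarded-rename-avoiding {y} {ρ} (μ t) h = Guarded-rename-avoiding t h′
  where
  h′ : ∀ z → ext ρ z ≢ suc y
  h′ zero    ()
  h′ (suc z) e = h z (suc-injective e)

Guarded-subst : ∀ {x y s} t → (∀ n → n ≢ x → Guarded y (s n)) → Guarded x t → Guarded y (subst s t)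
Guarded-subst 𝟎         h g        = tt
Guarded-subst (var n)   h g        = h n g
Guarded-subst (α ∙ t)   h g        = tt
Guarded-subst (σ∙ t)    h g        = Guarded-subst t h g
Guarded-subst (t ⊕ u)   h (g , g′) = Guarded-subst t h g , Guarded-subst u h g′
Guarded-subst (t ∥ u)   h (g , g′) = Guarded-subst t h g , Guarded-subst u h g′
Guarded-subst (t ∖ L)   h g        = Guarded-subst t h g
Guarded-subst (t ⟦ f ⟧) h g        = Guarded-subst t h g
Guarded-subst {x} {y} {s} (μ t) h g = Guarded-subst t h′ g
  where
  h′ : ∀ n → n ≢ suc x → Guarded (suc y) (exts s n)
  h′ zero    _  ()
  h′ (suc n) n≢ = Guarded-rename (s n) (λ z z≢ e → z≢ (suc-injective e)) (h n (λ e → n≢ (cong suc e)))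

Guarded-exts : ∀ s n → n ≢ zero → Guarded zero (exts s n)
Guarded-exts s zero    n≢ = ⊥-elim (n≢ refl)
Guarded-exts s (suc n) _  = Guarded-rename-avoiding (s n) (λ z ())

U-subst : ∀ s t {β} → U t β → U (subst s t) β
U-subst s (α ∙ t)   u                            = u
U-subst s (t ⊕ t′)  (inj₁ u)                     = inj₁ (U-subst s t u)
U-subst s (t ⊕ t′)  (inj₂ u)                     = inj₂ (U-subst s t′ u)
U-subst s (t ∥ t′)  (inj₁ u)                     = inj₁ (U-subst s t u)
U-subst s (t ∥ t′)  (inj₂ (inj₁ u))              = inj₂ (inj₁ (U-subst s t′ u))
U-subst s (t ∥ t′)  (inj₂ (inj₂ (e , a , u , v))) = inj₂ (inj₂ (e , a , U-subst s t u , U-subst s t′ v))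
U-subst s (t ∖ L)   (u , ∉L)                     = U-subst s t u , ∉L
U-subst s (t ⟦ f ⟧) (α , u , e)                  = α , U-subst s t u , e
U-subst s (μ t)     u                            = U-subst (exts s) t u

subst-step : ∀ s {P α P′} → P —[ α ]→ P′ → subst s P —[ α ]→ subst s P′
subst-step s pre          = pre
subst-step s (sigT t)     = sigT (subst-step s t)
subst-step s (sumL t)     = sumL (subst-step s t)
subst-step s (sumR t)     = sumR (subst-step s t)
subst-step s (parL t)     = parL (subst-step s t)
subst-step s (parR t)     = parR (subst-step s t)
subst-step s (renT t)     = renT (subst-step s t)
subst-step s (resT t ∉L)  = resT (subst-step s t) ∉L
subst-step s (com t u)    = com (subst-step s t) (subst-step s u)
subst-step s {α = α} (muT {P = P} {P′} t) =
  Eq.subst (_ —[ α ]→_) (sym (subst-sub0 s P′ (μ P))) (muT (subst-step (exts s) t))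

sub0-step : ∀ M {A α A′} → A —[ α ]→ A′ → sub0 A M —[ α ]→ sub0 A′ M
sub0-step M {A} {α} {A′} t =
  Eq.subst₂ (_—[ α ]→_) (sym (sub0≡subst-zero A M)) (sym (sub0≡subst-zero A′ M)) (subst-step (subst-zero M) t)

IsVar : Tm → Set
IsVar t = ∃ λ m → t ≡ var m

IsVar-no-step : ∀ {t α X} → IsVar t → t —[ α ]→ X → ⊥
IsVar-no-step (m , refl) ()

IsVar-no-clock : ∀ {t X} → IsVar t → t —σ→ X → ⊥
IsVar-no-clock (m , refl) ()

VarExcept : ℕ → (ℕ → Tm) → Set
VarExcept x s = ∀ n → n ≢ x → IsVar (s n)

VarExcept-exts : ∀ {x s} → VarExcept x s → VarExcept (suc x) (exts s)
VarExcept-exts h zero    _  = zero , refl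
VarExcept-exts h (suc n) n≢ with h n (λ e → n≢ (cong suc e))
... | m , eq = suc m , cong (rename suc) eq

VarExcept-subst-zero : ∀ M → VarExcept zero (subst-zero M)
VarExcept-subst-zero M zero    n≢ = ⊥-elim (n≢ refl)
VarExcept-subst-zero M (suc n) _  = n , refl

-- Only x may be replaced by a term that can move, and x is guarded in P, so
-- the transition is already one of P.
subst-step-inv : ∀ {x s} P {α X} → Guarded x P → VarExcept x s →
                 subst s P —[ α ]→ X → ∃ λ P′ → P —[ α ]→ P′ × X ≡ subst s P′
subst-step-inv (var n) g h t = ⊥-elim (IsVar-no-step (h n g) t)
subst-step-inv (β ∙ P) g h pre = P , pre , refl
subst-step-inv (σ∙ P) g h (sigT t) with subst-step-inv P g h t
... | P′ , t′ , eq = P′ , sigT t′ , eq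
subst-step-inv (P ⊕ Q) (g , _) h (sumL t) with subst-step-inv P g h t
... | P′ , t′ , eq = P′ , sumL t′ , eq
subst-step-inv (P ⊕ Q) (_ , g) h (sumR t) with subst-step-inv Q g h t
... | Q′ , t′ , eq = Q′ , sumR t′ , eq
subst-step-inv {s = s} (P ∥ Q) (g , _) h (parL t) with subst-step-inv P g h t
... | P′ , t′ , eq = P′ ∥ Q , parL t′ , cong (_∥ subst s Q) eq
subst-step-inv {s = s} (P ∥ Q) (_ , g) h (parR t) with subst-step-inv Q g h t
... | Q′ , t′ , eq = P ∥ Q′ , parR t′ , cong (subst s P ∥_) eq
subst-step-inv (P ∥ Q) (g , g′) h (com t u) with subst-step-inv P g h t | subst-step-inv Q g′ h u
... | P′ , t′ , eq | Q′ , u′ , eq′ = P′ ∥ Q′ , com t′ u′ , cong₂ _∥_ eq eq′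
subst-step-inv (P ∖ L) g h (resT t ∉L) with subst-step-inv P g h t
... | P′ , t′ , eq = P′ ∖ L , resT t′ ∉L , cong (_∖ L) eq
subst-step-inv (P ⟦ f ⟧) g h (renT t) with subst-step-inv P g h t
... | P′ , t′ , eq = P′ ⟦ f ⟧ , renT t′ , cong (_⟦ f ⟧) eq
subst-step-inv {s = s} (μ P) g h (muT t) with subst-step-inv P g (VarExcept-exts h) t
... | P′ , t′ , eq = sub0 P′ (μ P) , muT t′ ,
      trans (cong (λ Z → sub0 Z (μ subst (exts s) P)) eq) (sym (subst-sub0 s P′ (μ P)))

subst-clock-inv : ∀ {x s} P {X} → Guarded x P → VarExcept x s →
                  subst s P —σ→ X → ∃ λ P′ → P —σ→ P′ × X ≡ subst s P′
subst-clock-inv 𝟎 g h nilC = 𝟎 , nilC , refl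
subst-clock-inv (var n) g h t = ⊥-elim (IsVar-no-clock (h n g) t)
subst-clock-inv (β ∙ P) g h actC = β ∙ P , actC , refl
subst-clock-inv (σ∙ P) g h sigC = P , sigC , refl
subst-clock-inv (P ⊕ Q) (g , g′) h (sumC t u) with subst-clock-inv P g h t | subst-clock-inv Q g′ h u
... | P′ , t′ , eq | Q′ , u′ , eq′ = P′ ⊕ Q′ , sumC t′ u′ , cong₂ _⊕_ eq eq′
subst-clock-inv {s = s} (P ∥ Q) (g , g′) h (parC t u ¬τ) with subst-clock-inv P g h t | subst-clock-inv Q g′ h u
... | P′ , t′ , eq | Q′ , u′ , eq′ =
      P′ ∥ Q′ , parC t′ u′ (λ τ∈ → ¬τ (U-subst s (P ∥ Q) τ∈)) , cong₂ _∥_ eq eq′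
subst-clock-inv (P ∖ L) g h (resC t) with subst-clock-inv P g h t
... | P′ , t′ , eq = P′ ∖ L , resC t′ , cong (_∖ L) eq
subst-clock-inv (P ⟦ f ⟧) g h (renC t) with subst-clock-inv P g h t
... | P′ , t′ , eq = P′ ⟦ f ⟧ , renC t′ , cong (_⟦ f ⟧) eq
subst-clock-inv {s = s} (μ P) g h (muC t) with subst-clock-inv P g (VarExcept-exts h) t
... | P′ , t′ , eq = sub0 P′ (μ P) , muC t′ ,
      trans (cong (λ Z → sub0 Z (μ subst (exts s) P)) eq) (sym (subst-sub0 s P′ (μ P)))

sub0-step-inv : ∀ A M {α X} → Guarded zero A → sub0 A M —[ α ]→ X →
                ∃ λ A′ → A —[ α ]→ A′ × X ≡ sub0 A′ M
sub0-step-inv A M {α} {X} g t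
  with subst-step-inv A g (VarExcept-subst-zero M) (Eq.subst (_—[ α ]→ X) (sub0≡subst-zero A M) t)
... | A′ , t′ , eq = A′ , t′ , trans eq (sym (sub0≡subst-zero A′ M))

sub0-clock-inv : ∀ A M {X} → Guarded zero A → sub0 A M —σ→ X →
                 ∃ λ A′ → A —σ→ A′ × X ≡ sub0 A′ M
sub0-clock-inv A M {X} g t
  with subst-clock-inv A g (VarExcept-subst-zero M) (Eq.subst (_—σ→ X) (sub0≡subst-zero A M) t)
... | A′ , t′ , eq = A′ , t′ , trans eq (sym (sub0≡subst-zero A′ M))

WF-rename : ∀ ρ t → WF t → WF (rename ρ t)
WF-rename ρ 𝟎         w        = tt
WF-rename ρ (var n)   w        = tt
WF-rename ρ (α ∙ t)   w        = WF-rename ρ t w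
WF-rename ρ (σ∙ t)    w        = WF-rename ρ t w
WF-rename ρ (t ⊕ u)   (w , w′) = WF-rename ρ t w , WF-rename ρ u w′
WF-rename ρ (t ∥ u)   (w , w′) = WF-rename ρ t w , WF-rename ρ u w′
WF-rename ρ (t ∖ L)   w        = WF-rename ρ t w
WF-rename ρ (t ⟦ f ⟧) w        = WF-rename ρ t w
WF-rename ρ (μ t)     (g , w)  = Guarded-rename t h g , WF-rename (ext ρ) t w
  where
  h : ∀ z → z ≢ zero → ext ρ z ≢ zero
  h zero    z≢ = ⊥-elim (z≢ refl)
  h (suc z) _  ()

WF-subst : ∀ s t → (∀ n → WF (s n)) → WF t → WF (subst s t)
WF-subst s 𝟎         ws w        = tt
WF-subst s (var n)   ws w        = ws n
WF-subst s (α ∙ t)   ws w        = WF-subst s t ws w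
WF-subst s (σ∙ t)    ws w        = WF-subst s t ws w
WF-subst s (t ⊕ u)   ws (w , w′) = WF-subst s t ws w , WF-subst s u ws w′
WF-subst s (t ∥ u)   ws (w , w′) = WF-subst s t ws w , WF-subst s u ws w′
WF-subst s (t ∖ L)   ws w        = WF-subst s t ws w
WF-subst s (t ⟦ f ⟧) ws w        = WF-subst s t ws w
WF-subst s (μ t)     ws (g , w)  = Guarded-subst t (Guarded-exts s) g , WF-subst (exts s) t ws′ w
  where
  ws′ : ∀ n → WF (exts s n)
  ws′ zero    = tt
  ws′ (suc n) = WF-rename suc (s n) (ws n)

WF-sub0 : ∀ P M → WF P → WF M → WF (sub0 P M)
WF-sub0 P M wP wM = Eq.subst WF (sym (sub0≡subst-zero P M)) (WF-subst (subst-zero M) P ws wP)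
  where
  ws : ∀ n → WF (subst-zero M n)
  ws zero    = wM
  ws (suc n) = tt

WF-step : ∀ {P α P′} → WF P → P —[ α ]→ P′ → WF P′
WF-step w        pre         = w
WF-step w        (sigT t)    = WF-step w t
WF-step (g , w)  (muT {P = P} {P′} t) = WF-sub0 P′ (μ P) (WF-step w t) (g , w)
WF-step (w , _)  (sumL t)    = WF-step w t
WF-step (_ , w)  (sumR t)    = WF-step w t
WF-step (w , w′) (parL t)    = WF-step w t , w′
WF-step (w , w′) (parR t)    = w , WF-step w′ t
WF-step w        (renT t)    = WF-step w t
WF-step w        (resT t _)  = WF-step w t
WF-step (w , w′) (com t u)   = WF-step w t , WF-step w′ u

WF-clock : ∀ {P P′} → WF P → P —σ→ P′ → WF P′
WF-clock w        nilC        = tt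
WF-clock w        actC        = w
WF-clock w        sigC        = w
WF-clock (g , w)  (muC {P = P} {P′} t) = WF-sub0 P′ (μ P) (WF-clock w t) (g , w)
WF-clock w        (resC t)    = WF-clock w t
WF-clock w        (renC t)    = WF-clock w t
WF-clock (w , w′) (sumC t u)  = WF-clock w t , WF-clock w′ u
WF-clock (w , w′) (parC t u _) = WF-clock w t , WF-clock w′ u

ClosedUnder-rename : ∀ {n m} ρ t → (∀ z → z < n → ρ z < m) → ClosedUnder n t → ClosedUnder m (rename ρ t)
ClosedUnder-rename ρ 𝟎         h c        = tt
ClosedUnder-rename ρ (var k)   h c        = h k c
ClosedUnder-rename ρ (α ∙ t)   h c        = ClosedUnder-rename ρ t h c
ClosedUnder-rename ρ (σ∙ t)    h c        = ClosedUnder-rename ρ t h c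
ClosedUnder-rename ρ (t ⊕ u)   h (c , c′) = ClosedUnder-rename ρ t h c , ClosedUnder-rename ρ u h c′
ClosedUnder-rename ρ (t ∥ u)   h (c , c′) = ClosedUnder-rename ρ t h c , ClosedUnder-rename ρ u h c′
ClosedUnder-rename ρ (t ∖ L)   h c        = ClosedUnder-rename ρ t h c
ClosedUnder-rename ρ (t ⟦ f ⟧) h c        = ClosedUnder-rename ρ t h c
ClosedUnder-rename {n} {m} ρ (μ t) h c = ClosedUnder-rename (ext ρ) t h′ c
  where
  h′ : ∀ z → z < suc n → ext ρ z < suc m
  h′ zero    _       = s≤s z≤n
  h′ (suc z) (s≤s z<n) = s≤s (h z z<n)

ClosedUnder-subst : ∀ {n m} s t → (∀ z → z < n → ClosedUnder m (s z)) →
                    ClosedUnder n t → ClosedUnder m (subst s t)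
ClosedUnder-subst s 𝟎         h c        = tt
ClosedUnder-subst s (var k)   h c        = h k c
ClosedUnder-subst s (α ∙ t)   h c        = ClosedUnder-subst s t h c
ClosedUnder-subst s (σ∙ t)    h c        = ClosedUnder-subst s t h c
ClosedUnder-subst s (t ⊕ u)   h (c , c′) = ClosedUnder-subst s t h c , ClosedUnder-subst s u h c′
ClosedUnder-subst s (t ∥ u)   h (c , c′) = ClosedUnder-subst s t h c , ClosedUnder-subst s u h c′
ClosedUnder-subst s (t ∖ L)   h c        = ClosedUnder-subst s t h c
ClosedUnder-subst s (t ⟦ f ⟧) h c        = ClosedUnder-subst s t h c
ClosedUnder-subst {n} {m} s (μ t) h c = ClosedUnder-subst (exts s) t h′ c
  where
  h′ : ∀ z → z < suc n → ClosedUnder (suc m) (exts s z)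
  h′ zero    _         = s≤s z≤n
  h′ (suc z) (s≤s z<n) = ClosedUnder-rename suc (s z) (λ _ → s≤s) (h z z<n)

ClosedUnder-sub0 : ∀ {n} P M → ClosedUnder (suc n) P → ClosedUnder n M → ClosedUnder n (sub0 P M)
ClosedUnder-sub0 {n} P M cP cM =
  Eq.subst (ClosedUnder n) (sym (sub0≡subst-zero P M)) (ClosedUnder-subst (subst-zero M) P h cP)
  where
  h : ∀ z → z < suc n → ClosedUnder n (subst-zero M z)
  h zero    _         = cM
  h (suc z) (s≤s z<n) = z<n

ClosedUnder-step : ∀ {n P α P′} → ClosedUnder n P → P —[ α ]→ P′ → ClosedUnder n P′
ClosedUnder-step c        pre        = c
ClosedUnder-step c        (sigT t)   = ClosedUnder-step c t
ClosedUnder-step c        (muT {P = P} {P′} t) = ClosedUnder-sub0 P′ (μ P) (ClosedUnder-step c t) c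
ClosedUnder-step (c , _)  (sumL t)   = ClosedUnder-step c t
ClosedUnder-step (_ , c)  (sumR t)   = ClosedUnder-step c t
ClosedUnder-step (c , c′) (parL t)   = ClosedUnder-step c t , c′
ClosedUnder-step (c , c′) (parR t)   = c , ClosedUnder-step c′ t
ClosedUnder-step c        (renT t)   = ClosedUnder-step c t
ClosedUnder-step c        (resT t _) = ClosedUnder-step c t
ClosedUnder-step (c , c′) (com t u)  = ClosedUnder-step c t , ClosedUnder-step c′ u

ClosedUnder-clock : ∀ {n P P′} → ClosedUnder n P → P —σ→ P′ → ClosedUnder n P′
ClosedUnder-clock c        nilC         = tt
ClosedUnder-clock c        actC         = c
ClosedUnder-clock c        sigC         = c
ClosedUnder-clock c        (muC {P = P} {P′} t) = ClosedUnder-sub0 P′ (μ P) (ClosedUnder-clock c t) c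
ClosedUnder-clock c        (resC t)     = ClosedUnder-clock c t
ClosedUnder-clock c        (renC t)     = ClosedUnder-clock c t
ClosedUnder-clock (c , c′) (sumC t u)   = ClosedUnder-clock c t , ClosedUnder-clock c′ u
ClosedUnder-clock (c , c′) (parC t u _) = ClosedUnder-clock c t , ClosedUnder-clock c′ u

IsProc-step : ∀ {P α P′} → IsProc P → P —[ α ]→ P′ → IsProc P′
IsProc-step (w , c) t = WF-step w t , ClosedUnder-step c t

IsProc-clock : ∀ {P P′} → IsProc P → P —σ→ P′ → IsProc P′
IsProc-clock (w , c) t = WF-clock w t , ClosedUnder-clock c t

Guarded-≽ : ∀ {x P′ P} → P′ ≽ P → Guarded x P → Guarded x P′
Guarded-≽ ≽-refl      g        = g
Guarded-≽ ≽-sig       g        = g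
Guarded-≽ (≽-par p q) (g , g′) = Guarded-≽ p g , Guarded-≽ q g′
Guarded-≽ (≽-sum p q) (g , g′) = Guarded-≽ p g , Guarded-≽ q g′
Guarded-≽ (≽-res p)   g        = Guarded-≽ p g
Guarded-≽ (≽-ren p)   g        = Guarded-≽ p g
Guarded-≽ {x} (≽-mu {P} {P′} p _) g =
  Eq.subst (Guarded x) (sym (sub0≡subst-zero P′ (μ P))) (Guarded-subst P′ h (Guarded-≽ p g))
  where
  h : ∀ n → n ≢ suc x → Guarded x (subst-zero (μ P) n)
  h zero    _  = g
  h (suc n) n≢ = λ e → n≢ (cong suc e)

U-≽ : ∀ {P′ P β} → P′ ≽ P → U P β → U P′ β
U-≽ ≽-refl      u                            = u
U-≽ (≽-par p q) (inj₁ u)                     = inj₁ (U-≽ p u)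
U-≽ (≽-par p q) (inj₂ (inj₁ u))              = inj₂ (inj₁ (U-≽ q u))
U-≽ (≽-par p q) (inj₂ (inj₂ (e , a , u , v))) = inj₂ (inj₂ (e , a , U-≽ p u , U-≽ q v))
U-≽ (≽-sum p q) (inj₁ u)                     = inj₁ (U-≽ p u)
U-≽ (≽-sum p q) (inj₂ u)                     = inj₂ (U-≽ q u)
U-≽ (≽-res p)   (u , ∉L)                     = U-≽ p u , ∉L
U-≽ (≽-ren p)   (α , u , e)                  = α , U-≽ p u , e
U-≽ {β = β} (≽-mu {P} {P′} p _) u =
  Eq.subst (λ Z → U Z β) (sym (sub0≡subst-zero P′ (μ P))) (U-subst (subst-zero (μ P)) P′ (U-≽ p u))

≽-subst : ∀ s {P′ P} → P′ ≽ P → subst s P′ ≽ subst s P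
≽-subst s ≽-refl      = ≽-refl
≽-subst s ≽-sig       = ≽-sig
≽-subst s (≽-par p q) = ≽-par (≽-subst s p) (≽-subst s q)
≽-subst s (≽-sum p q) = ≽-sum (≽-subst s p) (≽-subst s q)
≽-subst s (≽-res p)   = ≽-res (≽-subst s p)
≽-subst s (≽-ren p)   = ≽-ren (≽-subst s p)
≽-subst s (≽-mu {P} {P′} p g) =
  Eq.subst (_≽ μ subst (exts s) P) (sym (subst-sub0 s P′ (μ P)))
    (≽-mu (≽-subst (exts s) p) (Guarded-subst P (Guarded-exts s) g))

≽-sub0 : ∀ M {A B} → A ≽ B → sub0 A M ≽ sub0 B M
≽-sub0 M {A} {B} r =
  Eq.subst₂ _≽_ (sym (sub0≡subst-zero A M)) (sym (sub0≡subst-zero B M)) (≽-subst (subst-zero M) r)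

clock⇒≽ : ∀ {P P′} → WF P → P —σ→ P′ → P′ ≽ P
clock⇒≽ w        nilC         = ≽-refl
clock⇒≽ w        actC         = ≽-refl
clock⇒≽ w        sigC         = ≽-sig
clock⇒≽ (g , w)  (muC t)      = ≽-mu (clock⇒≽ w t) g
clock⇒≽ w        (resC t)     = ≽-res (clock⇒≽ w t)
clock⇒≽ w        (renC t)     = ≽-ren (clock⇒≽ w t)
clock⇒≽ (w , w′) (sumC t u)   = ≽-sum (clock⇒≽ w t) (clock⇒≽ w′ u)
clock⇒≽ (w , w′) (parC t u _) = ≽-par (clock⇒≽ w t) (clock⇒≽ w′ u)

≽-stepˡ : ∀ {P′ P α X} → P′ ≽ P → P′ —[ α ]→ X → ∃ λ Y → P —[ α ]→ Y × X ≽ Y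
≽-stepˡ ≽-refl t = _ , t , ≽-refl
≽-stepˡ ≽-sig  t = _ , sigT t , ≽-refl
≽-stepˡ (≽-par p q) (parL t) with ≽-stepˡ p t
... | _ , t′ , r = _ , parL t′ , ≽-par r q
≽-stepˡ (≽-par p q) (parR t) with ≽-stepˡ q t
... | _ , t′ , r = _ , parR t′ , ≽-par p r
≽-stepˡ (≽-par p q) (com t u) with ≽-stepˡ p t | ≽-stepˡ q u
... | _ , t′ , r | _ , u′ , r′ = _ , com t′ u′ , ≽-par r r′
≽-stepˡ (≽-sum p q) (sumL t) with ≽-stepˡ p t
... | _ , t′ , r = _ , sumL t′ , r
≽-stepˡ (≽-sum p q) (sumR t) with ≽-stepˡ q t
... | _ , t′ , r = _ , sumR t′ , r
≽-stepˡ (≽-res p) (resT t ∉L) with ≽-stepˡ p t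
... | _ , t′ , r = _ , resT t′ ∉L , ≽-res r
≽-stepˡ (≽-ren p) (renT t) with ≽-stepˡ p t
... | _ , t′ , r = _ , renT t′ , ≽-ren r
≽-stepˡ (≽-mu {P} {P′} p g) t with sub0-step-inv P′ (μ P) (Guarded-≽ p g) t
... | _ , t₁ , refl with ≽-stepˡ p t₁
... | Y , t₂ , r = sub0 Y (μ P) , muT t₂ , ≽-sub0 (μ P) r

≽-stepʳ : ∀ {P′ P α Y} → P′ ≽ P → P —[ α ]→ Y → ∃ λ X → P′ —[ α ]→ X × X ≽ Y
≽-stepʳ ≽-refl t        = _ , t , ≽-refl
≽-stepʳ ≽-sig  (sigT t) = _ , t , ≽-refl
≽-stepʳ (≽-par p q) (parL t) with ≽-stepʳ p t
... | _ , t′ , r = _ , parL t′ , ≽-par r q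
≽-stepʳ (≽-par p q) (parR t) with ≽-stepʳ q t
... | _ , t′ , r = _ , parR t′ , ≽-par p r
≽-stepʳ (≽-par p q) (com t u) with ≽-stepʳ p t | ≽-stepʳ q u
... | _ , t′ , r | _ , u′ , r′ = _ , com t′ u′ , ≽-par r r′
≽-stepʳ (≽-sum p q) (sumL t) with ≽-stepʳ p t
... | _ , t′ , r = _ , sumL t′ , r
≽-stepʳ (≽-sum p q) (sumR t) with ≽-stepʳ q t
... | _ , t′ , r = _ , sumR t′ , r
≽-stepʳ (≽-res p) (resT t ∉L) with ≽-stepʳ p t
... | _ , t′ , r = _ , resT t′ ∉L , ≽-res r
≽-stepʳ (≽-ren p) (renT t) with ≽-stepʳ p t
... | _ , t′ , r = _ , renT t′ , ≽-ren r
≽-stepʳ (≽-mu {P} p _) (muT t) with ≽-stepʳ p t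
... | X , t′ , r = sub0 X (μ P) , sub0-step (μ P) t′ , ≽-sub0 (μ P) r

≽-clockˡ : ∀ {P′ P X} → P′ ≽ P → WF P → P′ —σ→ X → ∃ λ Y → P —σ→ Y × X ≽ Y
≽-clockˡ ≽-refl w t = _ , t , ≽-refl
≽-clockˡ ≽-sig  w t = _ , sigC , clock⇒≽ w t
≽-clockˡ (≽-par p q) (w , w′) (parC t u ¬τ) with ≽-clockˡ p w t | ≽-clockˡ q w′ u
... | _ , t′ , r | _ , u′ , r′ = _ , parC t′ u′ (λ τ∈ → ¬τ (U-≽ (≽-par p q) τ∈)) , ≽-par r r′
≽-clockˡ (≽-sum p q) (w , w′) (sumC t u) with ≽-clockˡ p w t | ≽-clockˡ q w′ u
... | _ , t′ , r | _ , u′ , r′ = _ , sumC t′ u′ , ≽-sum r r′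
≽-clockˡ (≽-res p) w (resC t) with ≽-clockˡ p w t
... | _ , t′ , r = _ , resC t′ , ≽-res r
≽-clockˡ (≽-ren p) w (renC t) with ≽-clockˡ p w t
... | _ , t′ , r = _ , renC t′ , ≽-ren r
≽-clockˡ (≽-mu {P} {P′} p g) (_ , w) t with sub0-clock-inv P′ (μ P) (Guarded-≽ p g) t
... | _ , t₁ , refl with ≽-clockˡ p w t₁
... | Y , t₂ , r = sub0 Y (μ P) , muC t₂ , ≽-sub0 (μ P) r

≽-Clauses : ∀ {P Q} → WF Q → P ≽ Q → Clauses _≽_ P Q
≽-Clauses wQ r = (λ _ _ → ≽-stepˡ r) , (λ _ _ → ≽-stepʳ r) , (λ _ → ≽-clockˡ r wQ)

Clauses-restrict : ∀ {I : Tm → Set} {R : Tm → Tm → Set} →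
                   (∀ {P α P′} → I P → P —[ α ]→ P′ → I P′) → (∀ {P P′} → I P → P —σ→ P′ → I P′) →
                   ∀ {P Q} → I P → I Q → Clauses R P Q → Clauses (λ P Q → I P × I Q × R P Q) P Q
Clauses-restrict I-step I-clock iP iQ (stepˡ , stepʳ , clockˡ) =
  (λ α P′ t → let (Q′ , u , r) = stepˡ α P′ t in Q′ , u , I-step iP t , I-step iQ u , r) ,
  (λ α Q′ t → let (P′ , u , r) = stepʳ α Q′ t in P′ , u , I-step iP u , I-step iQ t , r) ,
  (λ P′ t → let (Q′ , u , r) = clockˡ P′ t in Q′ , u , I-clock iP t , I-clock iQ u , r)

Clauses-TransClosure : ∀ {R : Tm → Tm → Set} → (∀ {P Q} → R P Q → Clauses R P Q) →
                       ∀ {P Q} → TransClosure R P Q → Clauses (TransClosure R) P Q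
Clauses-TransClosure cl [ r ] with cl r
... | stepˡ , stepʳ , clockˡ =
  (λ α P′ t → map₂ (map₂ [_]) (stepˡ α P′ t)) ,
  (λ α Q′ t → map₂ (map₂ [_]) (stepʳ α Q′ t)) ,
  (λ P′ t → map₂ (map₂ [_]) (clockˡ P′ t))
Clauses-TransClosure cl (r ∷ rs) with cl r | Clauses-TransClosure cl rs
... | stepˡ , stepʳ , clockˡ | stepˡ⁺ , stepʳ⁺ , clockˡ⁺ =
  (λ α P′ t → let (M′ , u , r′) = stepˡ α P′ t ; (Q′ , v , rs′) = stepˡ⁺ α M′ u in Q′ , v , r′ ∷ rs′) ,
  (λ α Q′ t → let (M′ , u , rs′) = stepʳ⁺ α Q′ t ; (P′ , v , r′) = stepʳ α M′ u in P′ , v , r′ ∷ rs′) ,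
  (λ P′ t → let (M′ , u , r′) = clockˡ P′ t ; (Q′ , v , rs′) = clockˡ⁺ M′ u in Q′ , v , r′ ∷ rs′)

≽̂-Clauses : ∀ {P Q} → P ≽̂ Q → Clauses _≽̂_ P Q
≽̂-Clauses (wP , wQ , r) = Clauses-restrict WF-step WF-clock wP wQ (≽-Clauses wQ r)

≽⁺-Clauses : (P Q : Tm) → P ≽⁺ Q → Clauses _≽⁺_ P Q
≽⁺-Clauses P Q = Clauses-TransClosure ≽̂-Clauses

≽⁺∩Proc-NaiveFT : NaiveFT ≽⁺∩Proc
≽⁺∩Proc-NaiveFT P Q (pP , pQ , r) =
  pP , pQ , Clauses-restrict IsProc-step IsProc-clock pP pQ (≽⁺-Clauses P Q r)

proposition9 : ((P Q : Tm) → P ≽⁺ Q → Clauses _≽⁺_ P Q)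
    × NaiveFT ≽⁺∩Proc
    × ((P Q : Tm) → ≽⁺∩Proc P Q → P ⊒1nv Q)
proposition9 = ≽⁺-Clauses , ≽⁺∩Proc-NaiveFT , λ P Q r → ≽⁺∩Proc , ≽⁺∩Proc-NaiveFT , r
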